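{- Let $k\geq 3$ be an integer. Then: (i) $f_{i,j}(n)+1=f_{i,j-1}(n)$ for all $n\in\mathbb N$ and all integers $i,j$ with $k-3\leq i\leq k-2$ and $-F(i+1)\geq j\geq 2-F(k)$; (ii) $f_{k-3,1-F(k)}(a(n))+1=f_{k-2,-F(k-1)}(n)$ for all $n\in\mathbb N$; (iii) $f_{k-3,1-F(k)}(b(n))+1=f_{k-3,-F(k-2)}(b(n)+1)$ for all $n\in\mathbb N$; (iv) $f_{k-2,1-F(k)}(n)+1=f_{k-3,-F(k-2)}(a(n)+1)$ for all $n\in\mathbb N$.
   Context: Let $\varphi=\frac{1+\sqrt5}{2}$ and $\mathbb N=\{1,2,3,\dots\}$. For $n\in\mathbb N$ put $a(n)=\lfloor n\varphi\rfloor$ and $b(n)=\lfloor n\varphi^2\rfloor$. $F$ denotes the Fibonacci sequence, $F(0)=0$, $F(1)=F(2)=1$, $F(n)=F(n-1)+F(n-2)$. For $i\in\mathbb Z^{\geq 0}$ and $j\in\mathbb Z$ define $f_{i,j}(n)=F(i+1)a(n)+F(i)n-j$ for $n\in\mathbb N$. -}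

module Defs where

open import Data.Nat as ℕ using (ℕ; zero; suc; _∸_; _^_; _≤?_)
open import Data.Integer as ℤ using (ℤ; +_)
open import Relation.Nullary using (does)
open import Data.Bool using (if_then_else_)

F : ℕ → ℕ
F zero = zero
F (suc zero) = 1
F (suc (suc n)) = F (suc n) ℕ.+ F n

-- Exact test, without reals, of  m ≤ n·(c + √5)/2  for natural m, n, c:
-- it is equivalent to 2m - cn ≤ n√5, i.e. (2m ∸ cn)² ≤ 5n²
-- (if 2m ≤ cn the left side is 0 and the inequality is trivially true).
LeHalf : ℕ → ℕ → ℕ → Set
LeHalf c n m = (2 ℕ.* m ∸ c ℕ.* n) ^ 2 ℕ.≤ 5 ℕ.* n ^ 2

countLe : ℕ → ℕ → ℕ → ℕ
countLe c n zero = zero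
countLe c n (suc B) =
  countLe c n B ℕ.+ (if does ((2 ℕ.* suc B ∸ c ℕ.* n) ^ 2 ≤? 5 ℕ.* n ^ 2) then 1 else 0)

-- ⌊ n·(c+√5)/2 ⌋ for c ∈ {1,3}: the number of positive integers m ≤ n(c+√5)/2;
-- all of these lie below (c+2)·n since (c+√5)/2 < c+2.
floorHalf : ℕ → ℕ → ℕ
floorHalf c n = countLe c n ((c ℕ.+ 2) ℕ.* n)

-- a(n) = ⌊ n φ ⌋,  φ = (1+√5)/2
a : ℕ → ℕ
a n = floorHalf 1 n

-- b(n) = ⌊ n φ² ⌋,  φ² = (3+√5)/2
b : ℕ → ℕ
b n = floorHalf 3 n

f : ℕ → ℤ → ℕ → ℤ
f i j n = (+ (F (suc i) ℕ.* a n)) ℤ.+ (+ (F i ℕ.* n)) ℤ.- j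

-- Part (i) is an identity valid for all i, j and n; parts (ii)-(iv) are Fibonacci-weighted
-- forms of three Beatty identities: with q = a(n) and b(n) = q + n,
--   a(q) = q + n - 1,   a(q + 1) = q + n + 1,   a(b(n) + 1) = a(b(n)) + 1.
-- Since q < nφ < q + 1 (strictly, φ being irrational), each reduces to placing some mφ
-- between consecutive integers. Whether m ≤ nφ is decided by the sign of m² − mn − n², which
-- the substitution (m, n) ↦ (m + n, m) negates; applying it once or twice, plus φ < 2, suffices.
module Submission where

open import Defs

module GoldenFloor where
  open import Data.Nat
  open import Data.Nat.Properties
  open import Data.Nat.Induction using (<-wellFounded)
  open import Data.Nat.Tactic.RingSolver using (solve-∀)
  open import Data.Product using (∃; _×_; _,_; proj₁; proj₂)
  open import Data.Sum using (inj₁; inj₂)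
  open import Function.Base using (_∘_)
  open import Function.Bundles using (_⇔_; mk⇔; Equivalence)
  import Function.Properties.Equivalence as ⇔
  open import Induction.WellFounded using (Acc; acc)
  open import Relation.Nullary using (¬_; yes; no; contradiction)
  open import Relation.Nullary.Decidable using (dec-true; dec-false)
  open import Relation.Binary.PropositionalEquality
  open Equivalence using (to; from)

  ≤-offset : ∀ {x y u v} w → x ≡ u + w → y ≡ v + w → x ≤ y ⇔ u ≤ v
  ≤-offset {u = u} {v} w refl refl = mk⇔ (+-cancelʳ-≤ w u v) (+-monoˡ-≤ w)

  module _ {c n : ℕ} where

    LeHalf-antimono : ∀ {k m} → k ≤ m → LeHalf c n m → LeHalf c n k
    LeHalf-antimono k≤m = ≤-trans (^-monoˡ-≤ 2 (∸-monoˡ-≤ (c * n) (*-monoʳ-≤ 2 k≤m)))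

    LeHalf-zero : LeHalf c n 0
    LeHalf-zero rewrite 0∸n≡0 (c * n) = z≤n

    countLe-suc-yes : ∀ {B} → LeHalf c n (suc B) → countLe c n (suc B) ≡ suc (countLe c n B)
    countLe-suc-yes {B} h rewrite dec-true (_ ≤? _) h = +-comm (countLe c n B) 1

    countLe-suc-no : ∀ {B} → ¬ LeHalf c n (suc B) → countLe c n (suc B) ≡ countLe c n B
    countLe-suc-no {B} ¬h rewrite dec-false (_ ≤? _) ¬h = +-identityʳ (countLe c n B)

    countLe-full : ∀ {B} → LeHalf c n B → countLe c n B ≡ B
    countLe-full {zero} _ = refl
    countLe-full {suc B} h =
      trans (countLe-suc-yes h) (cong suc (countLe-full (LeHalf-antimono (n≤1+n B) h)))

    countLe-threshold : ∀ {q B} → LeHalf c n q → ¬ LeHalf c n (suc q) → q ≤ B → countLe c n B ≡ q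
    countLe-threshold hq ¬hq q≤B with m≤n⇒m<n∨m≡n q≤B
    ... | inj₂ refl = countLe-full hq
    ... | inj₁ (s≤s q≤B) =
      trans (countLe-suc-no (¬hq ∘ LeHalf-antimono (s≤s q≤B))) (countLe-threshold hq ¬hq q≤B)

    LeHalf-threshold : ∀ B → ¬ LeHalf c n B → ∃ λ q → LeHalf c n q × ¬ LeHalf c n (suc q)
    LeHalf-threshold zero ¬h = contradiction LeHalf-zero ¬h
    LeHalf-threshold (suc B) ¬h with (2 * B ∸ c * n) ^ 2 ≤? 5 * n ^ 2
    ... | yes h = B , h , ¬h
    ... | no ¬h′ = LeHalf-threshold B ¬h′

  LeHalf-+ : ∀ c n m → LeHalf (2 + c) n (m + n) ⇔ LeHalf c n m
  LeHalf-+ c n m = mk⇔ (subst Square≤ shift) (subst Square≤ (sym shift))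
    where
    Square≤ : ℕ → Set
    Square≤ d = d ^ 2 ≤ 5 * n ^ 2
    expand : ∀ c n m → 2 * (m + n) ∸ (2 + c) * n ≡ 2 * n + 2 * m ∸ (2 * n + c * n)
    expand c n m = cong₂ _∸_ (lhs m n) (rhs c n)
      where
      lhs : ∀ m n → 2 * (m + n) ≡ 2 * n + 2 * m
      lhs = solve-∀
      rhs : ∀ c n → (2 + c) * n ≡ 2 * n + c * n
      rhs = solve-∀
    shift : 2 * (m + n) ∸ (2 + c) * n ≡ 2 * m ∸ c * n
    shift = trans (expand c n m) ([m+n]∸[m+o]≡n∸o (2 * n) (2 * m) (c * n))

  -- m ≤φ n and m ≥φ n say m ≤ nφ and m ≥ nφ: since φ² = φ + 1, both compare m² with mn + n².
  infix 4 _≤φ_ _≥φ_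

  _≤φ_ : ℕ → ℕ → Set
  m ≤φ n = m * m ≤ m * n + n * n

  _≥φ_ : ℕ → ℕ → Set
  m ≥φ n = m * n + n * n ≤ m * m

  ^2≡* : ∀ e → e ^ 2 ≡ e * e
  ^2≡* e = cong (e *_) (*-identityʳ e)

  LeHalf-1⇔≤φ : ∀ n m → LeHalf 1 n m ⇔ m ≤φ n
  LeHalf-1⇔≤φ n m with ≤-total (2 * m) (1 * n)
  ... | inj₁ 2m≤n = mk⇔ (λ _ → small-≤φ) (λ _ → small-LeHalf)
    where
    m≤n : m ≤ n
    m≤n = ≤-trans (m≤m+n m (m + 0)) (≤-trans 2m≤n (≤-reflexive (*-identityˡ n)))
    small-≤φ : m ≤φ n
    small-≤φ = ≤-trans (*-monoʳ-≤ m m≤n) (m≤m+n (m * n) (n * n))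
    small-LeHalf : LeHalf 1 n m
    small-LeHalf rewrite m≤n⇒m∸n≡0 2m≤n = z≤n
  ... | inj₂ n≤2m = mk⇔ (λ h → *-cancelˡ-≤ 4 (from scaled h)) (λ h → to scaled (*-monoʳ-≤ 4 h))
    where
    e : ℕ
    e = 2 * m ∸ 1 * n
    2m≡e+n : 2 * m ≡ e + n
    2m≡e+n = trans (sym (m∸n+n≡m n≤2m)) (cong (e +_) (*-identityˡ n))
    w : ℕ
    w = n * n + 2 * n * e
    4m²≡ : 4 * (m * m) ≡ e ^ 2 + w
    4m²≡ = trans (double m) (trans (cong (λ t → t * t) 2m≡e+n)
             (trans (square e n) (cong (_+ w) (sym (^2≡* e)))))
      where
      double : ∀ m → 4 * (m * m) ≡ (2 * m) * (2 * m)
      double = solve-∀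
      square : ∀ e n → (e + n) * (e + n) ≡ e * e + (n * n + 2 * n * e)
      square = solve-∀
    4mn+4n²≡ : 4 * (m * n + n * n) ≡ 5 * n ^ 2 + w
    4mn+4n²≡ = trans (double m n) (trans (cong (λ t → 2 * t * n + 4 * (n * n)) 2m≡e+n)
                 (trans (expand e n) (cong (λ t → 5 * t + w) (sym (^2≡* n)))))
      where
      double : ∀ m n → 4 * (m * n + n * n) ≡ 2 * (2 * m) * n + 4 * (n * n)
      double = solve-∀
      expand : ∀ e n → 2 * (e + n) * n + 4 * (n * n) ≡ 5 * (n * n) + (n * n + 2 * n * e)
      expand = solve-∀
    scaled : 4 * (m * m) ≤ 4 * (m * n + n * n) ⇔ LeHalf 1 n m
    scaled = ≤-offset w 4m²≡ 4mn+4n²≡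

  ≤φ-reflect : ∀ m n → m + n ≤φ m ⇔ m ≥φ n
  ≤φ-reflect m n = ≤-offset (m * m + m * n) (lhs m n) (rhs m n)
    where
    lhs : ∀ m n → (m + n) * (m + n) ≡ (m * n + n * n) + (m * m + m * n)
    lhs = solve-∀
    rhs : ∀ m n → (m + n) * m + m * m ≡ m * m + (m * m + m * n)
    rhs = solve-∀

  ≥φ-reflect : ∀ m n → m + n ≥φ m ⇔ m ≤φ n
  ≥φ-reflect m n = ≤-offset (m * m + m * n) (lhs m n) (rhs m n)
    where
    lhs : ∀ m n → (m + n) * m + m * m ≡ m * m + (m * m + m * n)
    lhs = solve-∀
    rhs : ∀ m n → (m + n) * (m + n) ≡ (m * n + n * n) + (m * m + m * n)
    rhs = solve-∀

  ≤φ-reflect² : ∀ m n → m + n + m ≤φ m + n ⇔ m ≤φ n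
  ≤φ-reflect² m n = ⇔.trans (≤φ-reflect (m + n) m) (≥φ-reflect m n)

  ≤φ⇒≤2* : ∀ {m n} → m ≤φ n → m ≤ 2 * n
  ≤φ⇒≤2* {m} {n} h = ≮⇒≥ λ 2n<m →
    let d , 2n+1+d≡m = m≤n⇒∃[o]m+o≡n 2n<m
    in m+1+n≰m _ (≤-trans (≤-reflexive (sym (excess n d))) (subst (_≤φ n) (sym 2n+1+d≡m) h))
    where
    excess : ∀ n d → suc (2 * n + d) * suc (2 * n + d)
                   ≡ (suc (2 * n + d) * n + n * n) + suc (n * n + 3 * n + 3 * (n * d) + 2 * d + d * d)
    excess = solve-∀

  ≤φ-suc-strict : ∀ {m n} → m ≤φ n → ¬ suc m ≥φ suc n
  ≤φ-suc-strict {m} {n} h h′ =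
    <⇒≱ (s≤s (*-monoˡ-≤ n {2} {3} (s≤s (s≤s z≤n)))) (≤-trans 3n+1≤m (≤φ⇒≤2* {m} {n} h))
    where
    w : ℕ
    w = m * m + m * n + n * n + 1
    lhs : ∀ m n → suc m * suc n + suc n * suc n + m * m ≡ (m + suc (3 * n)) + (m * m + m * n + n * n + 1)
    lhs = solve-∀
    rhs : ∀ m n → suc m * suc m + (m * n + n * n) ≡ (m + m) + (m * m + m * n + n * n + 1)
    rhs = solve-∀
    3n+1≤m : suc (3 * n) ≤ m
    3n+1≤m = +-cancelˡ-≤ m _ _ (to (≤-offset w (lhs m n) (rhs m n)) (+-mono-≤ h′ h))

  ≤φ-suc : ∀ {m n} → m ≤φ n → suc m ≤φ suc n
  ≤φ-suc {m} {n} = ≰⇒≥ ∘ ≤φ-suc-strict {m} {n}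

  ≰φ-pred : ∀ {m n} → ¬ suc m ≤φ suc n → m ≥φ n
  ≰φ-pred {m} {n} ¬h with m * n + n * n ≤? m * m
  ... | yes h = h
  ... | no ¬h′ = contradiction (≤φ-suc {m} {n} (≰⇒≥ ¬h′)) ¬h

  ≥φ⇒≥ : ∀ {m n} → m ≥φ n → n ≤ m
  ≥φ⇒≥ {m} {n} h = ≮⇒≥ λ m<n → n²≰0 m<n (+-cancelˡ-≤ (m * n) (n * n) 0 (begin
      m * n + n * n ≤⟨ h ⟩
      m * m         ≤⟨ *-monoʳ-≤ m (<⇒≤ m<n) ⟩
      m * n         ≡⟨ +-identityʳ (m * n) ⟨
      m * n + 0     ∎))
    where
    open ≤-Reasoning
    n²≰0 : m < n → ¬ n * n ≤ 0
    n²≰0 (s≤s _) ()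

  ≤φ0⇒≡0 : ∀ {n} → n ≤φ 0 → n ≡ 0
  ≤φ0⇒≡0 {zero} _ = refl
  ≤φ0⇒≡0 {suc n} h = contradiction (≤-trans h (≤-reflexive (cong (_+ 0) (*-zeroʳ (suc n))))) λ ()

  -- If m = nφ and m = n + d, the reflections give n = dφ with n < m: an infinite descent.
  φ-irrational : ∀ {m n} → m ≤φ n → m ≥φ n → n ≡ 0
  φ-irrational {m} = descend (<-wellFounded m)
    where
    descend : ∀ {m n} → Acc _<_ m → m ≤φ n → m ≥φ n → n ≡ 0
    descend {m} {n} (acc rec) h h′ with m≤n⇒∃[o]m+o≡n {n} {m} (≥φ⇒≥ h′)
    ... | zero , refl = ≤φ0⇒≡0 (to (≥φ-reflect n 0) h′)
    ... | suc d , refl =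
      contradiction (descend (rec (m<m+n n z<s)) (to (≥φ-reflect n (suc d)) h′) (to (≤φ-reflect n (suc d)) h))
                    λ ()

  a-unique : ∀ {n q} → q ≤φ n → ¬ suc q ≤φ n → a n ≡ q
  a-unique {n} {q} h ¬h =
    countLe-threshold {1} {n} (from (LeHalf-1⇔≤φ n q) h) (¬h ∘ to (LeHalf-1⇔≤φ n (suc q)))
      (≤-trans (≤φ⇒≤2* {q} {n} h) (*-monoˡ-≤ n {2} {3} (s≤s (s≤s z≤n))))

  a-spec : ∀ n → a n ≤φ n × ¬ suc (a n) ≤φ n
  a-spec n =
    let q , hq , ¬hq = LeHalf-threshold {1} {n} (suc (2 * n)) 2n+1≰φn
        q≤φn = to (LeHalf-1⇔≤φ n q) hq
        ¬1+q≤φn = ¬hq ∘ from (LeHalf-1⇔≤φ n (suc q))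
    in subst (λ r → r ≤φ n × ¬ suc r ≤φ n) (sym (a-unique {n} {q} q≤φn ¬1+q≤φn)) (q≤φn , ¬1+q≤φn)
    where
    2n+1≰φn : ¬ LeHalf 1 n (suc (2 * n))
    2n+1≰φn h = n≮n (2 * n) (≤φ⇒≤2* {suc (2 * n)} {n} (to (LeHalf-1⇔≤φ n _) h))

  a≤φ : ∀ n → a n ≤φ n
  a≤φ n = proj₁ (a-spec n)

  suc-a≰φ : ∀ n → ¬ suc (a n) ≤φ n
  suc-a≰φ n = proj₂ (a-spec n)

  b≡a+id : ∀ n → b n ≡ a n + n
  b≡a+id n = countLe-threshold {3} {n} (from (LeHalf-+ 1 n q) (from (LeHalf-1⇔≤φ n q) (a≤φ n)))
    (suc-a≰φ n ∘ to (LeHalf-1⇔≤φ n (suc q)) ∘ to (LeHalf-+ 1 n (suc q)))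
    (≤-trans (≤-reflexive (+-comm q n))
             (+-monoʳ-≤ n (≤-trans (≤φ⇒≤2* {q} {n} (a≤φ n)) (*-monoˡ-≤ n {2} {4} (s≤s (s≤s z≤n))))))
    where
    q : ℕ
    q = a n

  a∘a : ∀ n → a (a (suc n)) ≡ a (suc n) + n
  a∘a n = a-unique {q} {q + n} (from (≤φ-reflect q n) (≰φ-pred {q} {n} (suc-a≰φ (suc n))))
    λ h → contradiction (φ-irrational {q} {suc n} (a≤φ (suc n))
                          (to (≤φ-reflect q (suc n)) (subst (_≤φ q) (sym (+-suc q n)) h))) λ ()
    where
    q : ℕ
    q = a (suc n)

  a∘suc∘a : ∀ n → a (suc (a n)) ≡ suc (a n + n)
  a∘suc∘a n = a-unique {suc q} {suc (q + n)} (from (≤φ-reflect (suc q) n) (≰⇒≥ (suc-a≰φ n)))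
    λ h → ≤φ-suc-strict {q} {n} (a≤φ n)
            (to (≤φ-reflect (suc q) (suc n)) (subst (_≤φ suc q) (cong suc (sym (+-suc q n))) h))
    where
    q : ℕ
    q = a n

  a∘[a+id]-lower : ∀ n → a n + n + a n ≤φ a n + n
  a∘[a+id]-lower n = from (≤φ-reflect² (a n) n) (a≤φ n)

  a∘[a+id]-upper : ∀ n → ¬ suc (suc (a n + n + a n)) ≤φ suc (a n + n)
  a∘[a+id]-upper n h =
    suc-a≰φ n (to (≤φ-reflect² (suc q) n) (subst (_≤φ suc (q + n)) (cong suc (sym (+-suc (q + n) q))) h))
    where
    q : ℕ
    q = a n

  a∘[a+id] : ∀ n → a (a n + n) ≡ a n + n + a n
  a∘[a+id] n =
    a-unique {a n + n} (a∘[a+id]-lower n) (a∘[a+id]-upper n ∘ ≤φ-suc {suc (a n + n + a n)} {a n + n})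

  a∘suc∘[a+id] : ∀ n → a (suc (a n + n)) ≡ suc (a n + n + a n)
  a∘suc∘[a+id] n =
    a-unique {suc (a n + n)} (≤φ-suc {a n + n + a n} {a n + n} (a∘[a+id]-lower n)) (a∘[a+id]-upper n)

  a∘suc∘b : ∀ n → a (suc (b n)) ≡ suc (a (b n))
  a∘suc∘b n = begin
    a (suc (b n))        ≡⟨ cong (a ∘ suc) (b≡a+id n) ⟩
    a (suc (a n + n))    ≡⟨ a∘suc∘[a+id] n ⟩
    suc (a n + n + a n)  ≡⟨ cong suc (a∘[a+id] n) ⟨
    suc (a (a n + n))    ≡⟨ cong (suc ∘ a) (b≡a+id n) ⟨
    suc (a (b n))        ∎
    where
    open ≡-Reasoning

  weighted-a∘a : ∀ y x n →
    y * a (a (suc n)) + x * a (suc n) + (y + x + y) ≡ (y + x) * a (suc n) + y * suc n + (y + x)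
  weighted-a∘a y x n =
    trans (cong (λ r → y * r + x * a (suc n) + (y + x + y)) (a∘a n)) (identity y x (a (suc n)) n)
    where
    identity : ∀ y x q n → y * (q + n) + x * q + (y + x + y) ≡ (y + x) * q + y * suc n + (y + x)
    identity = solve-∀

  weighted-a∘suc∘b : ∀ y x n →
    y * a (b n) + x * b n + (y + x + y) ≡ y * a (suc (b n)) + x * suc (b n) + y
  weighted-a∘suc∘b y x n =
    trans (identity y x (a (b n)) (b n)) (cong (λ r → y * r + x * suc (b n) + y) (sym (a∘suc∘b n)))
    where
    identity : ∀ y x r s → y * r + x * s + (y + x + y) ≡ y * suc r + x * suc s + y
    identity = solve-∀

  weighted-a∘suc∘a : ∀ y x n →
    (y + x) * a n + y * n + (y + x + y) ≡ y * a (suc (a n)) + x * suc (a n) + y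
  weighted-a∘suc∘a y x n =
    trans (identity y x (a n) n) (cong (λ r → y * r + x * suc (a n) + y) (sym (a∘suc∘a n)))
    where
    identity : ∀ y x q n → (y + x) * q + y * n + (y + x + y) ≡ y * suc (q + n) + x * suc q + y
    identity = solve-∀

open GoldenFloor using (weighted-a∘a; weighted-a∘suc∘b; weighted-a∘suc∘a)

open import Data.Nat using (ℕ; suc; _∸_; _≤_; s≤s; z≤n)
open import Data.Integer using (ℤ; +_; -_; _+_; _-_)
open import Data.Integer as ℤ using ()
open import Data.Product using (_×_; _,_)
open import Relation.Binary.PropositionalEquality using (_≡_; sym; trans; cong)
import Data.Nat as ℕ
open import Data.Integer.Properties using (pos-+)
open import Data.Integer.Tactic.RingSolver using (solve-∀)

f-shift : ∀ i j n → f i j n + + 1 ≡ f i (j - + 1) n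
f-shift i j n = identity (+ (F (suc i) ℕ.* a n) + + (F i ℕ.* n)) j
  where
  identity : ∀ u j → u - j + + 1 ≡ u - (j - + 1)
  identity = solve-∀

pos-+₃ : ∀ u v w → + (u ℕ.+ v ℕ.+ w) ≡ + u + + v + + w
pos-+₃ u v w = trans (pos-+ (u ℕ.+ v) w) (cong (_+ + w) (pos-+ u v))

f[-c]≡ : ∀ i c n → f i (- + c) n ≡ + (F (suc i) ℕ.* a n ℕ.+ F i ℕ.* n ℕ.+ c)
f[-c]≡ i c n = trans (identity (+ (F (suc i) ℕ.* a n)) (+ (F i ℕ.* n)) (+ c))
                  (sym (pos-+₃ (F (suc i) ℕ.* a n) (F i ℕ.* n) c))
  where
  identity : ∀ u v w → u + v - - w ≡ u + v + w
  identity = solve-∀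

f[1-c]+1≡ : ∀ i c n → f i (+ 1 - + c) n + + 1 ≡ + (F (suc i) ℕ.* a n ℕ.+ F i ℕ.* n ℕ.+ c)
f[1-c]+1≡ i c n = trans (identity (+ (F (suc i) ℕ.* a n)) (+ (F i ℕ.* n)) (+ c))
                  (sym (pos-+₃ (F (suc i) ℕ.* a n) (F i ℕ.* n) c))
  where
  identity : ∀ u v w → u + v - (+ 1 - w) + + 1 ≡ u + v + w
  identity = solve-∀

theorem3p8 : (k : ℕ) → 3 ≤ k →
    ((n : ℕ) → 1 ≤ n → (i : ℕ) → (j : ℤ) →
      k ∸ 3 ≤ i → i ≤ k ∸ 2 → j ℤ.≤ - (+ F (suc i)) → (+ 2) - (+ F k) ℤ.≤ j →
      f i j n + (+ 1) ≡ f i (j - (+ 1)) n)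
    × ((n : ℕ) → 1 ≤ n →
      f (k ∸ 3) ((+ 1) - (+ F k)) (a n) + (+ 1) ≡ f (k ∸ 2) (- (+ F (k ∸ 1))) n)
    × ((n : ℕ) → 1 ≤ n →
      f (k ∸ 3) ((+ 1) - (+ F k)) (b n) + (+ 1) ≡ f (k ∸ 3) (- (+ F (k ∸ 2))) (suc (b n)))
    × ((n : ℕ) → 1 ≤ n →
      f (k ∸ 2) ((+ 1) - (+ F k)) n + (+ 1) ≡ f (k ∸ 3) (- (+ F (k ∸ 2))) (suc (a n)))
theorem3p8 (suc (suc (suc m))) (s≤s (s≤s (s≤s z≤n))) =
    (λ n _ i j _ _ _ _ → f-shift i j n)
  , (λ { (suc n) _ → trans (f[1-c]+1≡ m k (a (suc n)))
                       (trans (cong +_ (weighted-a∘a y x n)) (sym (f[-c]≡ (suc m) (F (suc (suc m))) (suc n)))) })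
  , (λ n _ → trans (f[1-c]+1≡ m k (b n))
               (trans (cong +_ (weighted-a∘suc∘b y x n)) (sym (f[-c]≡ m y (suc (b n))))))
  , (λ n _ → trans (f[1-c]+1≡ (suc m) k n)
               (trans (cong +_ (weighted-a∘suc∘a y x n)) (sym (f[-c]≡ m y (suc (a n))))))
  where
  k y x : ℕ
  k = F (suc (suc (suc m)))
  y = F (suc m)
  x = F m
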